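{- Let $Q$ and $R$ be two $\mathrm{TF}\Sigma_2^{dt}$ search problems and let $(f,g)$ be an $R$-formulation of $Q$ of size $s(n)$ and depth $d(n)$. If $R_m$ admits a Sherali-Adams refutation of degree $d'(m)$ (for each $m$), then $F_{R(f,g)_n}$ admits a Sherali-Adams refutation of degree $d(n)\big(d'(s(n))+2\big)$.
   Context: A $\mathrm{TF}\Sigma_2^{dt}$ problem $R$ is a sequence of relations $R_m\subseteq\{0,1\}^m\times\mathcal{O}^R_m\times\mathcal{W}^R_m$ where each predicate $a\mapsto R_m(a,b;c)$ is computed by a decision tree $R_{m,b,c}$ of depth $\mathrm{polylog}(m)$; $b$ is a solution for $a$ if $R_m(a,b;c)$ holds for all $c$, and every input has a solution. For a decision tree $T$, $\overline{T}$ is the DNF (and polynomial: sum of path-terms) of its rejecting paths. Terms are polynomials $\prod_{\text{positive}}a_i\prod_{\text{negated}}(1-a_j)$; arithmetic is multilinear; a conical junta is a finite sum of term polynomials. $F_{R_m}$ consists of the polynomials $\sum_{c\in\mathcal{W}^R_m}\overline{R}_{m,b,c}(a)-1$, $b\in\mathcal{O}^R_m$ (the sum running over all rejecting-path terms). A Sherali-Adams refutation of a collection of polynomials $\{P_k\}$ is a choice of conical juntas $\mathcal{J}_k,\mathcal{J}$ with $\sum_k\mathcal{J}_kP_k+\mathcal{J}=-1$; its degree is the maximum degree of the $\mathcal{J}_kP_k$ and $\mathcal{J}$. An $R$-formulation of $Q$ of size $s(n)$ and depth $d(n)$: decision trees $f_1,\dots,f_{s(n)}$ on $\{0,1\}^n$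 with outputs in $\{0,1\}$ and $g_b$ with outputs in $\mathcal{O}^Q_n$ ($b\in\mathcal{O}^R_{s(n)}$), all of depth at most $d(n)$, such that whenever $b$ is a solution of $R_{s(n)}$ for $f(x)$, $g_b(x)$ is a solution of $Q_n$ for $x$. For a polynomial $p(a_1,\dots,a_m)$, $p\circ f(x)$ is obtained by substituting for each $a_i$ the polynomial of $f_i$ (sum of the terms of its accepting paths). For $b\in\mathcal{O}^R_{s(n)}$ and $y\in\mathcal{O}^Q_n$, $G_{b,y}(x)$ is the sum of the terms of the paths of $g_b$ labeled $y$, and $\overline{G}_{b,y}$ the sum of the terms of the other paths. The reduced problem's formula $F_{R(f,g)_n}$ consists of the polynomials $\overline{G}_{b,y}(x)+\sum_{c\in\mathcal{W}^R_{s(n)}}\overline{R}_{s(n),b,c}\circ f(x)-1$, for all $b\in\mathcal{O}^R_{s(n)}$, $y\in\mathcal{O}^Q_n$. -}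

module Defs where

open import Data.Nat using (ℕ; zero; suc; _+_; _*_; _^_; _≤_; _⊔_)
open import Data.Nat.Logarithm using (⌈log₂_⌉)
open import Data.Bool using (Bool; true; false; not; if_then_else_)
open import Data.Bool.Properties using () renaming (_≟_ to _≟B_)
open import Data.Fin using (Fin) renaming (_≟_ to _≟F_)
open import Data.Fin.Subset using (Subset; ⊥; ⁅_⁆; _∪_; ∣_∣)
open import Data.Vec using (Vec; []; _∷_; lookup; tabulate)
open import Data.Vec.Properties using (≡-dec)
open import Data.List using (List; []; _∷_; _++_; map; foldr; concatMap; allFin; length)
import Data.List as L
open import Data.Integer using (ℤ; 0ℤ; 1ℤ; -1ℤ) renaming (_+_ to _+ℤ_; _*_ to _*ℤ_; -_ to -ℤ_)
open import Data.Product using (Σ; ∃; ∃-syntax; _×_; _,_; proj₁; proj₂)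
open import Relation.Nullary using (does; ¬_)
open import Relation.Binary.PropositionalEquality using (_≡_; _≢_)

-- Multilinear polynomials over ℤ in variables indexed by Fin n,
-- represented by their coefficient function on monomials
-- (a monomial = a subset of the variables).

Poly : ℕ → Set
Poly n = Subset n → ℤ

_≟S_ : ∀ {n} (S T : Subset n) → Relation.Nullary.Dec (S ≡ T)
_≟S_ = ≡-dec _≟B_

allSubsets : (n : ℕ) → List (Subset n)
allSubsets zero = [] ∷ []
allSubsets (suc n) = map (false ∷_) (allSubsets n) ++ map (true ∷_) (allSubsets n)

sumℤ : List ℤ → ℤ
sumℤ = foldr _+ℤ_ 0ℤ

_≈P_ : ∀ {n} → Poly n → Poly n → Set
p ≈P q = ∀ S → p S ≡ q S

constP : ∀ {n} → ℤ → Poly n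
constP c S = if does (S ≟S ⊥) then c else 0ℤ

0P 1P : ∀ {n} → Poly n
0P = constP 0ℤ
1P = constP 1ℤ

varP : ∀ {n} → Fin n → Poly n
varP i S = if does (S ≟S ⁅ i ⁆) then 1ℤ else 0ℤ

_+P_ : ∀ {n} → Poly n → Poly n → Poly n
(p +P q) S = p S +ℤ q S

-P_ : ∀ {n} → Poly n → Poly n
(-P p) S = -ℤ (p S)

_-P_ : ∀ {n} → Poly n → Poly n → Poly n
p -P q = p +P (-P q)

scaleP : ∀ {n} → ℤ → Poly n → Poly n
scaleP c p S = c *ℤ p S

-- multilinear product: x_i * x_i = x_i, i.e. monomials multiply by union
_*P_ : ∀ {n} → Poly n → Poly n → Poly n
_*P_ {n} p q S =
  sumℤ (concatMap (λ A → map (λ B → if does ((A ∪ B) ≟S S) then p A *ℤ q B else 0ℤ)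
                             (allSubsets n))
                  (allSubsets n))

sumP : ∀ {n} → List (Poly n) → Poly n
sumP = foldr _+P_ 0P

DegLE : ∀ {n} → Poly n → ℕ → Set
DegLE p d = ∀ S → p S ≢ 0ℤ → ∣ S ∣ ≤ d

data Lit (n : ℕ) : Set where
  pos : Fin n → Lit n
  neg : Fin n → Lit n

litP : ∀ {n} → Lit n → Poly n
litP (pos i) = varP i
litP (neg i) = 1P -P varP i

Term : ℕ → Set
Term n = List (Lit n)

termP : ∀ {n} → Term n → Poly n
termP = foldr (λ l acc → litP l *P acc) 1P

Junta : ℕ → Set
Junta n = List (Term n)

juntaP : ∀ {n} → Junta n → Poly n
juntaP J = sumP (map termP J)

data DT (n : ℕ) (A : Set) : Set where
  leaf : A → DT n A
  node : Fin n → DT n A → DT n A → DT n A   -- query a_i; left if 0, right if 1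

depth : ∀ {n A} → DT n A → ℕ
depth (leaf _) = 0
depth (node _ t₀ t₁) = suc (depth t₀ ⊔ depth t₁)

evalDT : ∀ {n A} → DT n A → Vec Bool n → A
evalDT (leaf a) x = a
evalDT (node i t₀ t₁) x = if lookup x i then evalDT t₁ x else evalDT t₀ x

paths : ∀ {n A} → DT n A → List (Term n × A)
paths (leaf a) = ([] , a) ∷ []
paths (node i t₀ t₁) =
  map (λ pa → (neg i ∷ proj₁ pa) , proj₂ pa) (paths t₀) ++
  map (λ pa → (pos i ∷ proj₁ pa) , proj₂ pa) (paths t₁)

pathSumP : ∀ {n A} → (A → Bool) → DT n A → Poly n
pathSumP P T = sumP (map (λ pa → if P (proj₂ pa) then termP (proj₁ pa) else 0P) (paths T))

acceptP : ∀ {n} → DT n Bool → Poly n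
acceptP = pathSumP (λ b → b)

rejectP : ∀ {n} → DT n Bool → Poly n
rejectP = pathSumP not

prodSub : ∀ {m n} → Subset m → (Fin m → Poly n) → Poly n
prodSub {m} S F = foldr (λ i acc → if lookup S i then F i *P acc else acc) 1P (allFin m)

composeP : ∀ {m n} → Poly m → (Fin m → Poly n) → Poly n
composeP {m} p F = sumP (map (λ S → scaleP (p S) (prodSub S F)) (allSubsets m))

record SARefutation {n : ℕ} (Ps : List (Poly n)) (D : ℕ) : Set where
  field
    Js  : Fin (length Ps) → Junta n
    J   : Junta n
    identity : (sumP (map (λ k → juntaP (Js k) *P L.lookup Ps k) (allFin (length Ps)))
                 +P juntaP J) ≈P constP -1ℤ
    degJsPs : ∀ k → DegLE (juntaP (Js k) *P L.lookup Ps k) D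
    degJ    : DegLE (juntaP J) D

-- TFΣ₂^dt problems. O m = |O_m|, W m = |W_m|.

record TFΣ2dt : Set where
  field
    O    : ℕ → ℕ
    W    : ℕ → ℕ
    tree : (m : ℕ) → Fin (O m) → Fin (W m) → DT m Bool
    polylogDepth : ∃[ C ] ∃[ k ] (∀ m b c → depth (tree m b c) ≤ C * (⌈log₂ m ⌉ ^ k) + C)

  IsSolution : (m : ℕ) → Vec Bool m → Fin (O m) → Set
  IsSolution m a b = ∀ c → evalDT (tree m b c) a ≡ true

  field
    total : ∀ m (a : Vec Bool m) → ∃[ b ] IsSolution m a b

  formula : (m : ℕ) → List (Poly m)
  formula m = map (λ b → sumP (map (λ c → rejectP (tree m b c)) (allFin (W m))) -P 1P)
                  (allFin (O m))

record Formulation (Q R : TFΣ2dt) (s d : ℕ → ℕ) : Set where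
  module Q = TFΣ2dt Q
  module R = TFΣ2dt R
  field
    f : (n : ℕ) → Fin (s n) → DT n Bool
    g : (n : ℕ) → Fin (R.O (s n)) → DT n (Fin (Q.O n))
    f-depth : ∀ n i → depth (f n i) ≤ d n
    g-depth : ∀ n b → depth (g n b) ≤ d n

  fx : (n : ℕ) → Vec Bool n → Vec Bool (s n)
  fx n x = tabulate (λ i → evalDT (f n i) x)

  field
    correct : ∀ n (x : Vec Bool n) (b : Fin (R.O (s n))) →
              R.IsSolution (s n) (fx n x) b → Q.IsSolution n x (evalDT (g n b) x)

  G Gbar : (n : ℕ) → Fin (R.O (s n)) → Fin (Q.O n) → Poly n
  G    n b y = pathSumP (λ z → does (z ≟F y)) (g n b)
  Gbar n b y = pathSumP (λ z → not (does (z ≟F y))) (g n b)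

  reducedFormula : (n : ℕ) → List (Poly n)
  reducedFormula n =
    concatMap (λ b → map (λ y → (Gbar n b y +P
                                   sumP (map (λ c → composeP (rejectP (R.tree (s n) b c))
                                                              (λ i → acceptP (f n i)))
                                             (allFin (R.W (s n)))))
                                  -P 1P)
                          (allFin (Q.O n)))
              (allFin (R.O (s n)))

{-# OPTIONS --safe #-}
-- A multilinear polynomial is determined by its values on the Boolean cube, so every polynomial
-- identity below is checked pointwise. Let Σ_b J_b φ_b + J = -1 be the given refutation of F_{R_m},
-- m = s(n). Substituting the accepting-path polynomials of f turns each junta into a junta again,
-- with degree multiplied by at most d(n). Multiply the polynomial ψ_{b,y} of F_{R(f,g)_n} by the junta
-- (J_b ∘ f) G_{b,y}: on inputs where g_b outputs y the term Gbar_{b,y} vanishes and ψ_{b,y} = φ_b ∘ f,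
-- elsewhere G_{b,y} vanishes. As g_b outputs exactly one y, summing over y gives (J_b φ_b) ∘ f, and
-- adding J ∘ f yields the refutation identity composed with f, i.e. -1. Each product equals
-- G_{b,y} · (J_b φ_b) ∘ f, of degree at most d(n) + d'(m) d(n) ≤ d(n) (d'(m) + 2).
module Submission where

open import Defs
open import Data.Nat using (ℕ; _+_; _*_)

open import Data.Nat using (zero; suc; _≤_; _<_; _≤?_; z≤n; s≤s)
open import Data.List.Relation.Unary.All as All using (All; []; _∷_)
import Data.List.Relation.Unary.All.Properties as All
import Data.Nat.Properties as ℕ
open import Data.Bool using (Bool; true; false; not; if_then_else_)
open import Data.Fin using (Fin; zero; suc; _≟_)
import Data.Fin.Properties as Fin
open import Data.Fin.Subset using (Subset; ⊥; ⁅_⁆; _∪_; ∣_∣)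
import Data.Fin.Subset.Properties as Subset
open import Data.Vec using (Vec; []; _∷_; lookup; tabulate)
import Data.Vec.Properties as Vec
open import Data.List using (List; []; _∷_; _++_; map; concatMap; allFin; length)
import Data.List as List
import Data.List.Properties as List
open import Data.Integer using (ℤ; 0ℤ; 1ℤ; -1ℤ) renaming (_+_ to _+ℤ_; _*_ to _*ℤ_; -_ to -ℤ_; _-_ to _-ℤ_)
import Data.Integer.Properties as ℤ
open import Data.Integer.Tactic.RingSolver using (solve-∀)
open import Data.Nat.Tactic.RingSolver using () renaming (solve-∀ to ℕ-solve-∀)
open import Data.Product using (_×_; _,_; proj₁; proj₂)
open import Function using (_∘_)
open import Relation.Nullary using (does; yes; no; contradiction)
open import Relation.Nullary.Decidable using (dec-true; dec-false)
open import Relation.Binary.PropositionalEquality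
  using (_≡_; _≢_; refl; sym; trans; cong; cong₂; subst; module ≡-Reasoning)

-- Finite sums

∑ : {A : Set} → List A → (A → ℤ) → ℤ
∑ xs h = sumℤ (map h xs)

sumℤ-++ : ∀ xs ys → sumℤ (xs ++ ys) ≡ sumℤ xs +ℤ sumℤ ys
sumℤ-++ []       ys = sym (ℤ.+-identityˡ _)
sumℤ-++ (x ∷ xs) ys = trans (cong (x +ℤ_) (sumℤ-++ xs ys)) (sym (ℤ.+-assoc x _ _))

module _ {A : Set} where

  ∑-cong : {h k : A → ℤ} → (∀ a → h a ≡ k a) → ∀ xs → ∑ xs h ≡ ∑ xs k
  ∑-cong h≡k []       = refl
  ∑-cong h≡k (x ∷ xs) = cong₂ _+ℤ_ (h≡k x) (∑-cong h≡k xs)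

  ∑-zero : {h : A → ℤ} → (∀ a → h a ≡ 0ℤ) → ∀ xs → ∑ xs h ≡ 0ℤ
  ∑-zero h≡0 xs = trans (∑-cong h≡0 xs) (sum0 xs)
    where
    sum0 : ∀ xs → ∑ xs (λ _ → 0ℤ) ≡ 0ℤ
    sum0 []       = refl
    sum0 (_ ∷ xs) = trans (ℤ.+-identityˡ _) (sum0 xs)

  ∑-++ : ∀ (h : A → ℤ) xs ys → ∑ (xs ++ ys) h ≡ ∑ xs h +ℤ ∑ ys h
  ∑-++ h xs ys = trans (cong sumℤ (List.map-++ h xs ys)) (sumℤ-++ (map h xs) _)

  ∑-map : ∀ {B : Set} (h : B → ℤ) (g : A → B) xs → ∑ (map g xs) h ≡ ∑ xs (h ∘ g)
  ∑-map h g xs = cong sumℤ (sym (List.map-∘ xs))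

  ∑-+ : ∀ (h k : A → ℤ) xs → ∑ xs (λ a → h a +ℤ k a) ≡ ∑ xs h +ℤ ∑ xs k
  ∑-+ h k []       = refl
  ∑-+ h k (x ∷ xs) = trans (cong (h x +ℤ k x +ℤ_) (∑-+ h k xs)) (interchange (h x) (k x) _ _)
    where
    interchange : ∀ a b c d → (a +ℤ b) +ℤ (c +ℤ d) ≡ (a +ℤ c) +ℤ (b +ℤ d)
    interchange = solve-∀

  ∑-*ˡ : ∀ c (h : A → ℤ) xs → ∑ xs (λ a → c *ℤ h a) ≡ c *ℤ ∑ xs h
  ∑-*ˡ c h []       = sym (ℤ.*-zeroʳ c)
  ∑-*ˡ c h (x ∷ xs) = trans (cong (c *ℤ h x +ℤ_) (∑-*ˡ c h xs)) (sym (ℤ.*-distribˡ-+ c _ _))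

  ∑-*ʳ : ∀ c (h : A → ℤ) xs → ∑ xs (λ a → h a *ℤ c) ≡ ∑ xs h *ℤ c
  ∑-*ʳ c h xs = trans (∑-cong (λ a → ℤ.*-comm (h a) c) xs) (trans (∑-*ˡ c h xs) (ℤ.*-comm c _))

  sumℤ-concatMap : (h : A → List ℤ) → ∀ xs → sumℤ (concatMap h xs) ≡ ∑ xs (sumℤ ∘ h)
  sumℤ-concatMap h []       = refl
  sumℤ-concatMap h (x ∷ xs) = trans (sumℤ-++ (h x) _) (cong (sumℤ (h x) +ℤ_) (sumℤ-concatMap h xs))

  ∑-concatMap : ∀ {B : Set} (k : B → ℤ) (h : A → List B) xs →
                ∑ (concatMap h xs) k ≡ ∑ xs (λ a → ∑ (h a) k)
  ∑-concatMap k h xs = trans (cong sumℤ (List.map-concatMap k h xs)) (sumℤ-concatMap (map k ∘ h) xs)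

∑-swap : ∀ {A B : Set} (h : A → B → ℤ) xs ys →
         ∑ xs (λ a → ∑ ys (h a)) ≡ ∑ ys (λ b → ∑ xs (λ a → h a b))
∑-swap h []       ys = sym (∑-zero (λ _ → refl) ys)
∑-swap h (x ∷ xs) ys =
  trans (cong (∑ ys (h x) +ℤ_) (∑-swap h xs ys)) (sym (∑-+ (h x) _ ys))

∑-cartesianProductWith : ∀ {A B C : Set} (k : C → ℤ) (_•_ : A → B → C) xs ys →
  ∑ (List.cartesianProductWith _•_ xs ys) k ≡ ∑ xs (λ a → ∑ ys (λ b → k (a • b)))
∑-cartesianProductWith k _•_ []       ys = refl
∑-cartesianProductWith k _•_ (x ∷ xs) ys =
  trans (∑-++ k (map (x •_) ys) _)
        (cong₂ _+ℤ_ (∑-map k (x •_) ys) (∑-cartesianProductWith k _•_ xs ys))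

-- Evaluation on the Boolean cube

𝟙 : Bool → ℤ
𝟙 true  = 1ℤ
𝟙 false = 0ℤ

monomial : ∀ {n} → Subset n → Vec Bool n → ℤ
monomial []          []      = 1ℤ
monomial (false ∷ S) (_ ∷ x) = monomial S x
monomial (true ∷ S)  (b ∷ x) = 𝟙 b *ℤ monomial S x

eval : ∀ {n} → Poly n → Vec Bool n → ℤ
eval {n} p x = ∑ (allSubsets n) (λ S → p S *ℤ monomial S x)

𝟙-idem : ∀ b → 𝟙 b *ℤ 𝟙 b ≡ 𝟙 b
𝟙-idem true  = refl
𝟙-idem false = refl

monomial-⊥ : ∀ {n} (x : Vec Bool n) → monomial ⊥ x ≡ 1ℤ
monomial-⊥ []      = refl
monomial-⊥ (_ ∷ x) = monomial-⊥ x

monomial-⁅⁆ : ∀ {n} (i : Fin n) (x : Vec Bool n) → monomial ⁅ i ⁆ x ≡ 𝟙 (lookup x i)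
monomial-⁅⁆ zero    (b ∷ x) = trans (cong (𝟙 b *ℤ_) (monomial-⊥ x)) (ℤ.*-identityʳ (𝟙 b))
monomial-⁅⁆ (suc i) (_ ∷ x) = monomial-⁅⁆ i x

monomial-∪ : ∀ {n} (A B : Subset n) x → monomial (A ∪ B) x ≡ monomial A x *ℤ monomial B x
monomial-∪ []          []          []      = refl
monomial-∪ (false ∷ A) (false ∷ B) (_ ∷ x) = monomial-∪ A B x
monomial-∪ (false ∷ A) (true ∷ B)  (b ∷ x) =
  trans (cong (𝟙 b *ℤ_) (monomial-∪ A B x)) (left-comm (𝟙 b) (monomial A x) (monomial B x))
  where
  left-comm : ∀ u a c → u *ℤ (a *ℤ c) ≡ a *ℤ (u *ℤ c)
  left-comm = solve-∀
monomial-∪ (true ∷ A)  (false ∷ B) (b ∷ x) =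
  trans (cong (𝟙 b *ℤ_) (monomial-∪ A B x)) (sym (ℤ.*-assoc (𝟙 b) _ _))
monomial-∪ (true ∷ A)  (true ∷ B)  (b ∷ x) =
  trans (cong (𝟙 b *ℤ_) (monomial-∪ A B x))
        (trans (cong (_*ℤ _) (sym (𝟙-idem b))) (interchange (𝟙 b) (𝟙 b) (monomial A x) (monomial B x)))
  where
  interchange : ∀ u v a c → (u *ℤ v) *ℤ (a *ℤ c) ≡ (u *ℤ a) *ℤ (v *ℤ c)
  interchange = solve-∀

δ-on : ∀ {n} (S : Subset n) (u : ℤ) → (if does (S ≟S S) then u else 0ℤ) ≡ u
δ-on S u = cong (λ b → if b then u else 0ℤ) (dec-true (S ≟S S) refl)

δ-off : ∀ {n} {S T : Subset n} (u : ℤ) → S ≢ T → (if does (S ≟S T) then u else 0ℤ) ≡ 0ℤ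
δ-off {S = S} {T} u S≢T = cong (λ b → if b then u else 0ℤ) (dec-false (S ≟S T) S≢T)

∑-allSubsets-suc : ∀ {n} (h : Subset (suc n) → ℤ) →
  ∑ (allSubsets (suc n)) h ≡ ∑ (allSubsets n) (h ∘ (false ∷_)) +ℤ ∑ (allSubsets n) (h ∘ (true ∷_))
∑-allSubsets-suc {n} h =
  trans (∑-++ h (map (false ∷_) (allSubsets n)) _)
        (cong₂ _+ℤ_ (∑-map h (false ∷_) (allSubsets n)) (∑-map h (true ∷_) (allSubsets n)))

∑-allSubsets-single : ∀ {n} (T : Subset n) (h : Subset n → ℤ) →
                      (∀ S → S ≢ T → h S ≡ 0ℤ) → ∑ (allSubsets n) h ≡ h T
∑-allSubsets-single {zero} [] h _ = ℤ.+-identityʳ (h [])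
∑-allSubsets-single {suc n} (false ∷ T) h off = begin
  ∑ (allSubsets (suc n)) h                                 ≡⟨ ∑-allSubsets-suc h ⟩
  ∑ (allSubsets n) (h ∘ (false ∷_)) +ℤ ∑ (allSubsets n) (h ∘ (true ∷_))
    ≡⟨ cong₂ _+ℤ_ (∑-allSubsets-single T (h ∘ (false ∷_)) (λ S S≢T → off _ (S≢T ∘ Vec.∷-injectiveʳ)))
                  (∑-zero (λ S → off _ (λ ())) (allSubsets n)) ⟩
  h (false ∷ T) +ℤ 0ℤ                                      ≡⟨ ℤ.+-identityʳ _ ⟩
  h (false ∷ T)                                            ∎
  where open ≡-Reasoning
∑-allSubsets-single {suc n} (true ∷ T) h off = begin
  ∑ (allSubsets (suc n)) h                                 ≡⟨ ∑-allSubsets-suc h ⟩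
  ∑ (allSubsets n) (h ∘ (false ∷_)) +ℤ ∑ (allSubsets n) (h ∘ (true ∷_))
    ≡⟨ cong₂ _+ℤ_ (∑-zero (λ S → off _ (λ ())) (allSubsets n))
                  (∑-allSubsets-single T (h ∘ (true ∷_)) (λ S S≢T → off _ (S≢T ∘ Vec.∷-injectiveʳ))) ⟩
  0ℤ +ℤ h (true ∷ T)                                       ≡⟨ ℤ.+-identityˡ _ ⟩
  h (true ∷ T)                                             ∎
  where open ≡-Reasoning

eval-≈P : ∀ {n} {p q : Poly n} → p ≈P q → ∀ x → eval p x ≡ eval q x
eval-≈P {n} p≈q x = ∑-cong (λ S → cong (_*ℤ monomial S x) (p≈q S)) (allSubsets n)

eval-+P : ∀ {n} (p q : Poly n) x → eval (p +P q) x ≡ eval p x +ℤ eval q x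
eval-+P {n} p q x =
  trans (∑-cong (λ S → ℤ.*-distribʳ-+ (monomial S x) (p S) (q S)) (allSubsets n))
        (∑-+ (λ S → p S *ℤ monomial S x) (λ S → q S *ℤ monomial S x) (allSubsets n))

eval-scaleP : ∀ {n} c (p : Poly n) x → eval (scaleP c p) x ≡ c *ℤ eval p x
eval-scaleP {n} c p x =
  trans (∑-cong (λ S → ℤ.*-assoc c (p S) (monomial S x)) (allSubsets n))
        (∑-*ˡ c (λ S → p S *ℤ monomial S x) (allSubsets n))

eval--P : ∀ {n} (p q : Poly n) x → eval (p -P q) x ≡ eval p x -ℤ eval q x
eval--P {n} p q x = begin
  eval (p -P q) x                ≡⟨ eval-+P p (-P q) x ⟩
  eval p x +ℤ eval (-P q) x      ≡⟨ cong (eval p x +ℤ_) (eval-≈P (λ S → sym (ℤ.-1*i≡-i (q S))) x) ⟩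
  eval p x +ℤ eval (scaleP -1ℤ q) x ≡⟨ cong (eval p x +ℤ_) (eval-scaleP -1ℤ q x) ⟩
  eval p x +ℤ -1ℤ *ℤ eval q x    ≡⟨ cong (eval p x +ℤ_) (ℤ.-1*i≡-i (eval q x)) ⟩
  eval p x -ℤ eval q x           ∎
  where open ≡-Reasoning

eval-constP : ∀ {n} c (x : Vec Bool n) → eval (constP c) x ≡ c
eval-constP {n} c x = begin
  eval (constP c) x   ≡⟨ ∑-allSubsets-single {n} ⊥ _ (λ S S≢⊥ → cong (_*ℤ monomial S x) (δ-off c S≢⊥)) ⟩
  constP c (⊥ {n}) *ℤ monomial (⊥ {n}) x ≡⟨ cong₂ _*ℤ_ (δ-on {n} ⊥ c) (monomial-⊥ x) ⟩
  c *ℤ 1ℤ             ≡⟨ ℤ.*-identityʳ c ⟩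
  c                   ∎
  where open ≡-Reasoning

eval-varP : ∀ {n} (i : Fin n) x → eval (varP i) x ≡ 𝟙 (lookup x i)
eval-varP {n} i x = begin
  eval (varP i) x     ≡⟨ ∑-allSubsets-single ⁅ i ⁆ _ (λ S S≢i → cong (_*ℤ monomial S x) (δ-off 1ℤ S≢i)) ⟩
  varP i ⁅ i ⁆ *ℤ monomial ⁅ i ⁆ x ≡⟨ cong₂ _*ℤ_ (δ-on ⁅ i ⁆ 1ℤ) (monomial-⁅⁆ i x) ⟩
  1ℤ *ℤ 𝟙 (lookup x i) ≡⟨ ℤ.*-identityˡ _ ⟩
  𝟙 (lookup x i)      ∎
  where open ≡-Reasoning

eval-*P : ∀ {n} (p q : Poly n) x → eval (p *P q) x ≡ eval p x *ℤ eval q x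
eval-*P {n} p q x = begin
  eval (p *P q) x
    ≡⟨ ∑-cong expand all ⟩
  ∑ all (λ S → ∑ all (λ A → ∑ all (λ B → c S A B)))
    ≡⟨ ∑-swap (λ S A → ∑ all (c S A)) all all ⟩
  ∑ all (λ A → ∑ all (λ S → ∑ all (λ B → c S A B)))
    ≡⟨ ∑-cong (λ A → ∑-swap (λ S B → c S A B) all all) all ⟩
  ∑ all (λ A → ∑ all (λ B → ∑ all (λ S → c S A B)))
    ≡⟨ ∑-cong (λ A → ∑-cong (collapse A) all) all ⟩
  ∑ all (λ A → ∑ all (λ B → (p A *ℤ monomial A x) *ℤ (q B *ℤ monomial B x)))
    ≡⟨ ∑-cong (λ A → ∑-*ˡ (p A *ℤ monomial A x) (λ B → q B *ℤ monomial B x) all) all ⟩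
  ∑ all (λ A → (p A *ℤ monomial A x) *ℤ eval q x)
    ≡⟨ ∑-*ʳ (eval q x) (λ A → p A *ℤ monomial A x) all ⟩
  eval p x *ℤ eval q x
    ∎
  where
  open ≡-Reasoning
  all = allSubsets n

  c : Subset n → Subset n → Subset n → ℤ
  c S A B = (if does ((A ∪ B) ≟S S) then p A *ℤ q B else 0ℤ) *ℤ monomial S x

  expand : ∀ S → (p *P q) S *ℤ monomial S x ≡ ∑ all (λ A → ∑ all (c S A))
  expand S =
    trans (cong (_*ℤ monomial S x)
                (sumℤ-concatMap (λ A → map (λ B → if does ((A ∪ B) ≟S S) then p A *ℤ q B else 0ℤ) all) all))
          (trans (sym (∑-*ʳ (monomial S x) _ all))
                 (∑-cong (λ A → sym (∑-*ʳ (monomial S x) _ all)) all))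

  collapse : ∀ A B → ∑ all (λ S → c S A B) ≡ (p A *ℤ monomial A x) *ℤ (q B *ℤ monomial B x)
  collapse A B = begin
    ∑ all (λ S → c S A B)
      ≡⟨ ∑-allSubsets-single (A ∪ B) _ (λ S S≢A∪B → cong (_*ℤ monomial S x) (δ-off _ (S≢A∪B ∘ sym))) ⟩
    c (A ∪ B) A B
      ≡⟨ cong₂ _*ℤ_ (δ-on (A ∪ B) (p A *ℤ q B)) (monomial-∪ A B x) ⟩
    (p A *ℤ q B) *ℤ (monomial A x *ℤ monomial B x)
      ≡⟨ interchange (p A) (q B) (monomial A x) (monomial B x) ⟩
    (p A *ℤ monomial A x) *ℤ (q B *ℤ monomial B x)
      ∎
    where
    interchange : ∀ a b u v → (a *ℤ b) *ℤ (u *ℤ v) ≡ (a *ℤ u) *ℤ (b *ℤ v)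
    interchange = solve-∀

eval-sumP-map : ∀ {n} {A : Set} (h : A → Poly n) xs x → eval (sumP (map h xs)) x ≡ ∑ xs (λ a → eval (h a) x)
eval-sumP-map h []       x = eval-constP 0ℤ x
eval-sumP-map h (a ∷ xs) x = trans (eval-+P (h a) _ x) (cong (eval (h a) x +ℤ_) (eval-sumP-map h xs x))

eval-if : ∀ {n} b (p : Poly n) x → eval (if b then p else 0P) x ≡ 𝟙 b *ℤ eval p x
eval-if true  p x = sym (ℤ.*-identityˡ _)
eval-if false p x = eval-constP 0ℤ x

eval-∷ : ∀ {n} (p : Poly (suc n)) b x →
         eval p (b ∷ x) ≡ eval (p ∘ (false ∷_)) x +ℤ 𝟙 b *ℤ eval (p ∘ (true ∷_)) x
eval-∷ {n} p b x =
  trans (∑-allSubsets-suc (λ S → p S *ℤ monomial S (b ∷ x)))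
        (cong (eval (p ∘ (false ∷_)) x +ℤ_)
              (trans (∑-cong (λ S → left-comm (p (true ∷ S)) (𝟙 b) (monomial S x)) (allSubsets n))
                     (∑-*ˡ (𝟙 b) (λ S → p (true ∷ S) *ℤ monomial S x) (allSubsets n))))
  where
  left-comm : ∀ a u c → a *ℤ (u *ℤ c) ≡ u *ℤ (a *ℤ c)
  left-comm = solve-∀

eval-zero⇒zero : ∀ {n} (p : Poly n) → (∀ x → eval p x ≡ 0ℤ) → ∀ S → p S ≡ 0ℤ
eval-zero⇒zero {zero}  p p≡0 [] = trans (sym (trans (ℤ.+-identityʳ _) (ℤ.*-identityʳ _))) (p≡0 [])
eval-zero⇒zero {suc n} p p≡0 (s ∷ S) = eval-zero⇒zero (p ∘ (s ∷_)) (slice-zero s) S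
  where
  open ≡-Reasoning
  p₀ p₁ : Poly n
  p₀ = p ∘ (false ∷_)
  p₁ = p ∘ (true ∷_)

  p₀-zero : ∀ x → eval p₀ x ≡ 0ℤ
  p₀-zero x = begin
    eval p₀ x                     ≡⟨ ℤ.+-identityʳ _ ⟨
    eval p₀ x +ℤ 0ℤ               ≡⟨ eval-∷ p false x ⟨
    eval p (false ∷ x)            ≡⟨ p≡0 (false ∷ x) ⟩
    0ℤ                            ∎

  slice-zero : ∀ s x → eval (p ∘ (s ∷_)) x ≡ 0ℤ
  slice-zero false = p₀-zero
  slice-zero true x = begin
    eval p₁ x                     ≡⟨ ℤ.+-identityˡ _ ⟨
    0ℤ +ℤ eval p₁ x               ≡⟨ cong₂ _+ℤ_ (p₀-zero x) (ℤ.*-identityˡ _) ⟨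
    eval p₀ x +ℤ 1ℤ *ℤ eval p₁ x  ≡⟨ eval-∷ p true x ⟨
    eval p (true ∷ x)             ≡⟨ p≡0 (true ∷ x) ⟩
    0ℤ                            ∎

eval-injective : ∀ {n} (p q : Poly n) → (∀ x → eval p x ≡ eval q x) → p ≈P q
eval-injective p q p≗q S = ℤ.i-j≡0⇒i≡j (p S) (q S) (eval-zero⇒zero (p -P q) difference-zero S)
  where
  difference-zero : ∀ x → eval (p -P q) x ≡ 0ℤ
  difference-zero x = trans (eval--P p q x) (trans (cong (_-ℤ eval q x) (p≗q x)) (ℤ.+-inverseʳ (eval q x)))

-- Degrees

-- DegLE in contrapositive form, so that closure under sums needs no test p S ≟ 0.
Deg≤ : ∀ {n} → Poly n → ℕ → Set
Deg≤ p d = ∀ S → d < ∣ S ∣ → p S ≡ 0ℤ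

Deg≤⇒DegLE : ∀ {n} {p : Poly n} {d} → Deg≤ p d → DegLE p d
Deg≤⇒DegLE {p = p} {d} p≤d S pS≢0 with ∣ S ∣ ≤? d
... | yes ∣S∣≤d = ∣S∣≤d
... | no  ∣S∣≰d = contradiction (p≤d S (ℕ.≰⇒> ∣S∣≰d)) pS≢0

DegLE⇒Deg≤ : ∀ {n} {p : Poly n} {d} → DegLE p d → Deg≤ p d
DegLE⇒Deg≤ {p = p} p≤d S d<∣S∣ with p S ℤ.≟ 0ℤ
... | yes pS≡0 = pS≡0
... | no  pS≢0 = contradiction (p≤d S pS≢0) (ℕ.<⇒≱ d<∣S∣)

deg≤-mono : ∀ {n} {p : Poly n} {d e} → d ≤ e → Deg≤ p d → Deg≤ p e
deg≤-mono d≤e p≤d S e<∣S∣ = p≤d S (ℕ.≤-<-trans d≤e e<∣S∣)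

deg≤-≈P : ∀ {n} {p q : Poly n} {d} → p ≈P q → Deg≤ p d → Deg≤ q d
deg≤-≈P p≈q p≤d S d<∣S∣ = trans (sym (p≈q S)) (p≤d S d<∣S∣)

deg≤-+P : ∀ {n} {p q : Poly n} {d} → Deg≤ p d → Deg≤ q d → Deg≤ (p +P q) d
deg≤-+P p≤d q≤d S d<∣S∣ = cong₂ _+ℤ_ (p≤d S d<∣S∣) (q≤d S d<∣S∣)

deg≤--P : ∀ {n} {p q : Poly n} {d} → Deg≤ p d → Deg≤ q d → Deg≤ (p -P q) d
deg≤--P p≤d q≤d S d<∣S∣ = cong₂ _-ℤ_ (p≤d S d<∣S∣) (q≤d S d<∣S∣)

deg≤-scaleP : ∀ {n} c {p : Poly n} {d} → Deg≤ p d → Deg≤ (scaleP c p) d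
deg≤-scaleP c p≤d S d<∣S∣ = trans (cong (c *ℤ_) (p≤d S d<∣S∣)) (ℤ.*-zeroʳ c)

deg≤-constP : ∀ {n} c {d} → Deg≤ (constP {n} c) d
deg≤-constP {n} c S d<∣S∣ = δ-off {S = S} c λ S≡⊥ →
  ℕ.<⇒≱ d<∣S∣ (ℕ.≤-trans (ℕ.≤-reflexive (trans (cong ∣_∣ S≡⊥) (Subset.∣⊥∣≡0 n))) z≤n)

deg≤-varP : ∀ {n} (i : Fin n) → Deg≤ (varP i) 1
deg≤-varP i S 1<∣S∣ = δ-off {S = S} 1ℤ λ S≡⁅i⁆ →
  ℕ.<⇒≱ 1<∣S∣ (ℕ.≤-reflexive (trans (cong ∣_∣ S≡⁅i⁆) (Subset.∣⁅x⁆∣≡1 i)))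

deg≤-sumP : ∀ {n} {ps : List (Poly n)} {d} → All (λ p → Deg≤ p d) ps → Deg≤ (sumP ps) d
deg≤-sumP []             = deg≤-constP 0ℤ
deg≤-sumP (p≤d ∷ ps≤d)   = deg≤-+P p≤d (deg≤-sumP ps≤d)

∣∪∣≤ : ∀ {n} (A B : Subset n) → ∣ A ∪ B ∣ ≤ ∣ A ∣ + ∣ B ∣
∣∪∣≤ []          []          = z≤n
∣∪∣≤ (false ∷ A) (false ∷ B) = ∣∪∣≤ A B
∣∪∣≤ (false ∷ A) (true ∷ B)  =
  ℕ.≤-trans (s≤s (∣∪∣≤ A B)) (ℕ.≤-reflexive (sym (ℕ.+-suc ∣ A ∣ ∣ B ∣)))
∣∪∣≤ (true ∷ A)  (false ∷ B) = s≤s (∣∪∣≤ A B)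
∣∪∣≤ (true ∷ A)  (true ∷ B)  =
  s≤s (ℕ.≤-trans (∣∪∣≤ A B) (ℕ.+-monoʳ-≤ ∣ A ∣ (ℕ.n≤1+n ∣ B ∣)))

deg≤-*P : ∀ {n} {p q : Poly n} {d e} → Deg≤ p d → Deg≤ q e → Deg≤ (p *P q) (d + e)
deg≤-*P {n} {p} {q} {d} {e} p≤d q≤e S d+e<∣S∣ =
  trans (sumℤ-concatMap _ (allSubsets n))
        (∑-zero (λ A → ∑-zero (summand-zero A) (allSubsets n)) (allSubsets n))
  where
  product-zero : ∀ A B → d + e < ∣ A ∪ B ∣ → p A *ℤ q B ≡ 0ℤ
  product-zero A B d+e<∣A∪B∣ with ∣ A ∣ ≤? d | ∣ B ∣ ≤? e
  ... | no ∣A∣≰d | _        = cong (_*ℤ q B) (p≤d A (ℕ.≰⇒> ∣A∣≰d))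
  ... | yes _    | no ∣B∣≰e = trans (cong (p A *ℤ_) (q≤e B (ℕ.≰⇒> ∣B∣≰e))) (ℤ.*-zeroʳ (p A))
  ... | yes ∣A∣≤d | yes ∣B∣≤e =
    contradiction (ℕ.≤-trans (∣∪∣≤ A B) (ℕ.+-mono-≤ ∣A∣≤d ∣B∣≤e)) (ℕ.<⇒≱ d+e<∣A∪B∣)

  summand-zero : ∀ A B → (if does ((A ∪ B) ≟S S) then p A *ℤ q B else 0ℤ) ≡ 0ℤ
  summand-zero A B with (A ∪ B) ≟S S
  ... | yes A∪B≡S = product-zero A B (subst (λ T → d + e < ∣ T ∣) (sym A∪B≡S) d+e<∣S∣)
  ... | no  _     = refl

-- Terms, juntas and decision trees

litHolds : ∀ {n} → Lit n → Vec Bool n → Bool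
litHolds (pos i) x = lookup x i
litHolds (neg i) x = not (lookup x i)

eval-litP : ∀ {n} (l : Lit n) x → eval (litP l) x ≡ 𝟙 (litHolds l x)
eval-litP (pos i) x = eval-varP i x
eval-litP (neg i) x =
  trans (eval--P 1P (varP i) x) (trans (cong₂ _-ℤ_ (eval-constP 1ℤ x) (eval-varP i x)) (1-𝟙 (lookup x i)))
  where
  1-𝟙 : ∀ b → 1ℤ -ℤ 𝟙 b ≡ 𝟙 (not b)
  1-𝟙 true  = refl
  1-𝟙 false = refl

eval-termP-∷ : ∀ {n} (l : Lit n) t x → eval (termP (l ∷ t)) x ≡ 𝟙 (litHolds l x) *ℤ eval (termP t) x
eval-termP-∷ l t x = trans (eval-*P (litP l) (termP t) x) (cong (_*ℤ eval (termP t) x) (eval-litP l x))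

eval-termP-++ : ∀ {n} (t u : Term n) x → eval (termP (t ++ u)) x ≡ eval (termP t) x *ℤ eval (termP u) x
eval-termP-++ []      u x = trans (sym (ℤ.*-identityˡ _)) (cong (_*ℤ eval (termP u) x) (sym (eval-constP 1ℤ x)))
eval-termP-++ (l ∷ t) u x = begin
  eval (termP (l ∷ t ++ u)) x
    ≡⟨ eval-termP-∷ l (t ++ u) x ⟩
  𝟙 (litHolds l x) *ℤ eval (termP (t ++ u)) x
    ≡⟨ cong (𝟙 (litHolds l x) *ℤ_) (eval-termP-++ t u x) ⟩
  𝟙 (litHolds l x) *ℤ (eval (termP t) x *ℤ eval (termP u) x)
    ≡⟨ ℤ.*-assoc (𝟙 (litHolds l x)) (eval (termP t) x) _ ⟨
  𝟙 (litHolds l x) *ℤ eval (termP t) x *ℤ eval (termP u) x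
    ≡⟨ cong (_*ℤ eval (termP u) x) (eval-termP-∷ l t x) ⟨
  eval (termP (l ∷ t)) x *ℤ eval (termP u) x
    ∎
  where open ≡-Reasoning

eval-juntaP : ∀ {n} (J : Junta n) x → eval (juntaP J) x ≡ ∑ J (λ t → eval (termP t) x)
eval-juntaP J x = eval-sumP-map termP J x

deg≤-termP : ∀ {n} (t : Term n) → Deg≤ (termP t) (length t)
deg≤-termP []      = deg≤-constP 1ℤ
deg≤-termP (l ∷ t) = deg≤-*P (deg≤-litP l) (deg≤-termP t)
  where
  deg≤-litP : ∀ l → Deg≤ (litP l) 1
  deg≤-litP (pos i) = deg≤-varP i
  deg≤-litP (neg i) = deg≤--P (deg≤-constP 1ℤ) (deg≤-varP i)

_⊗_ : ∀ {n} → Junta n → Junta n → Junta n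
_⊗_ = List.cartesianProductWith _++_

eval-⊗ : ∀ {n} (J K : Junta n) x → eval (juntaP (J ⊗ K)) x ≡ eval (juntaP J) x *ℤ eval (juntaP K) x
eval-⊗ J K x = begin
  eval (juntaP (J ⊗ K)) x
    ≡⟨ eval-juntaP (J ⊗ K) x ⟩
  ∑ (J ⊗ K) (λ t → eval (termP t) x)
    ≡⟨ ∑-cartesianProductWith (λ t → eval (termP t) x) _++_ J K ⟩
  ∑ J (λ t → ∑ K (λ u → eval (termP (t ++ u)) x))
    ≡⟨ ∑-cong (λ t → trans (∑-cong (λ u → eval-termP-++ t u x) K)
                           (∑-*ˡ (eval (termP t) x) (λ u → eval (termP u) x) K)) J ⟩
  ∑ J (λ t → eval (termP t) x *ℤ ∑ K (λ u → eval (termP u) x))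
    ≡⟨ ∑-*ʳ _ (λ t → eval (termP t) x) J ⟩
  ∑ J (λ t → eval (termP t) x) *ℤ ∑ K (λ u → eval (termP u) x)
    ≡⟨ cong₂ _*ℤ_ (eval-juntaP J x) (eval-juntaP K x) ⟨
  eval (juntaP J) x *ℤ eval (juntaP K) x
    ∎
  where open ≡-Reasoning

module _ {n : ℕ} {A : Set} (P : A → Bool) where

  pathWeight : Vec Bool n → Term n × A → ℤ
  pathWeight x (t , a) = 𝟙 (P a) *ℤ eval (termP t) x

  ∑-pathWeight-prefix : ∀ (l : Lit n) (ps : List (Term n × A)) x →
    ∑ (map (λ pa → (l ∷ proj₁ pa) , proj₂ pa) ps) (pathWeight x) ≡ 𝟙 (litHolds l x) *ℤ ∑ ps (pathWeight x)
  ∑-pathWeight-prefix l ps x =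
    trans (∑-map (pathWeight x) _ ps)
          (trans (∑-cong step ps) (∑-*ˡ (𝟙 (litHolds l x)) (pathWeight x) ps))
    where
    left-comm : ∀ u v w → u *ℤ (v *ℤ w) ≡ v *ℤ (u *ℤ w)
    left-comm = solve-∀
    step : ∀ pa → pathWeight x ((l ∷ proj₁ pa) , proj₂ pa) ≡ 𝟙 (litHolds l x) *ℤ pathWeight x pa
    step (t , a) = trans (cong (𝟙 (P a) *ℤ_) (eval-termP-∷ l t x))
                         (left-comm (𝟙 (P a)) (𝟙 (litHolds l x)) (eval (termP t) x))

  -- On each input exactly one path of a decision tree is consistent, the one leading to its output.
  ∑-paths : ∀ (T : DT n A) x → ∑ (paths T) (pathWeight x) ≡ 𝟙 (P (evalDT T x))
  ∑-paths (leaf a) x =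
    trans (ℤ.+-identityʳ _) (trans (cong (𝟙 (P a) *ℤ_) (eval-constP 1ℤ x)) (ℤ.*-identityʳ _))
  ∑-paths (node i t₀ t₁) x = begin
    ∑ (paths (node i t₀ t₁)) (pathWeight x)
      ≡⟨ ∑-++ (pathWeight x) (map (λ pa → (neg i ∷ proj₁ pa) , proj₂ pa) (paths t₀)) _ ⟩
    ∑ (map (λ pa → (neg i ∷ proj₁ pa) , proj₂ pa) (paths t₀)) (pathWeight x)
      +ℤ ∑ (map (λ pa → (pos i ∷ proj₁ pa) , proj₂ pa) (paths t₁)) (pathWeight x)
      ≡⟨ cong₂ _+ℤ_ (∑-pathWeight-prefix (neg i) (paths t₀) x) (∑-pathWeight-prefix (pos i) (paths t₁) x) ⟩
    𝟙 (not (lookup x i)) *ℤ ∑ (paths t₀) (pathWeight x) +ℤ 𝟙 (lookup x i) *ℤ ∑ (paths t₁) (pathWeight x)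
      ≡⟨ cong₂ (λ u v → 𝟙 (not (lookup x i)) *ℤ u +ℤ 𝟙 (lookup x i) *ℤ v)
               (∑-paths t₀ x) (∑-paths t₁ x) ⟩
    𝟙 (not (lookup x i)) *ℤ 𝟙 (P (evalDT t₀ x)) +ℤ 𝟙 (lookup x i) *ℤ 𝟙 (P (evalDT t₁ x))
      ≡⟨ branch (lookup x i) ⟩
    𝟙 (P (evalDT (node i t₀ t₁) x))
      ∎
    where
    open ≡-Reasoning
    branch : ∀ b → 𝟙 (not b) *ℤ 𝟙 (P (evalDT t₀ x)) +ℤ 𝟙 b *ℤ 𝟙 (P (evalDT t₁ x))
                   ≡ 𝟙 (P (if b then evalDT t₁ x else evalDT t₀ x))
    branch true  = trans (ℤ.+-identityˡ _) (ℤ.*-identityˡ _)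
    branch false = trans (ℤ.+-identityʳ _) (ℤ.*-identityˡ _)

  eval-pathSumP : ∀ (T : DT n A) x → eval (pathSumP P T) x ≡ 𝟙 (P (evalDT T x))
  eval-pathSumP T x =
    trans (eval-sumP-map _ (paths T) x)
          (trans (∑-cong (λ pa → eval-if (P (proj₂ pa)) (termP (proj₁ pa)) x) (paths T)) (∑-paths T x))

  pathJ : DT n A → Junta n
  pathJ T = concatMap (λ pa → if P (proj₂ pa) then proj₁ pa ∷ [] else []) (paths T)

  eval-pathJ : ∀ (T : DT n A) x → eval (juntaP (pathJ T)) x ≡ 𝟙 (P (evalDT T x))
  eval-pathJ T x =
    trans (eval-juntaP (pathJ T) x)
          (trans (∑-concatMap (λ t → eval (termP t) x) _ (paths T))
                 (trans (∑-cong selected (paths T)) (∑-paths T x)))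
    where
    selected : ∀ pa → ∑ (if P (proj₂ pa) then proj₁ pa ∷ [] else []) (λ t → eval (termP t) x) ≡ pathWeight x pa
    selected (t , a) with P a
    ... | true  = trans (ℤ.+-identityʳ _) (sym (ℤ.*-identityˡ _))
    ... | false = refl

  deg≤-pathSumP : ∀ (T : DT n A) {d} → depth T ≤ d → Deg≤ (pathSumP P T) d
  deg≤-pathSumP T depth≤d =
    deg≤-sumP (All.map⁺ (All.map (λ {pa} ∣t∣≤depth → deg≤-if (P (proj₂ pa))
                                      (deg≤-mono (ℕ.≤-trans ∣t∣≤depth depth≤d) (deg≤-termP (proj₁ pa))))
                                 (paths-length T)))
    where
    deg≤-if : ∀ b {p : Poly n} {d} → Deg≤ p d → Deg≤ (if b then p else 0P) d
    deg≤-if true  p≤d = p≤d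
    deg≤-if false _   = deg≤-constP 0ℤ

    paths-length : ∀ (T : DT n A) → All (λ pa → length (proj₁ pa) ≤ depth T) (paths T)
    paths-length (leaf a)       = z≤n ∷ []
    paths-length (node i t₀ t₁) = All.++⁺
      (All.map⁺ (All.map (λ ∣t∣≤ → s≤s (ℕ.≤-trans ∣t∣≤ (ℕ.m≤m⊔n (depth t₀) (depth t₁))))
                         (paths-length t₀)))
      (All.map⁺ (All.map (λ ∣t∣≤ → s≤s (ℕ.≤-trans ∣t∣≤ (ℕ.m≤n⊔m (depth t₀) (depth t₁))))
                         (paths-length t₁)))

-- Substitution

prodSub-∷ : ∀ {m n} s (S : Subset m) (F : Fin (suc m) → Poly n) →
  prodSub (s ∷ S) F ≡ (if s then F zero *P prodSub S (F ∘ suc) else prodSub S (F ∘ suc))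
prodSub-∷ {m} s S F = cong (λ X → if s then F zero *P X else X)
  (trans (cong (List.foldr step 1P) (sym (List.map-tabulate (λ i → i) suc))) (List.foldr-map step suc 1P (allFin m)))
  where
  step : Fin (suc m) → Poly _ → Poly _
  step i acc = if lookup (s ∷ S) i then F i *P acc else acc

eval-prodSub : ∀ {m n} (S : Subset m) (F : Fin m → Poly n) x (a : Vec Bool m) →
               (∀ i → eval (F i) x ≡ 𝟙 (lookup a i)) → eval (prodSub S F) x ≡ monomial S a
eval-prodSub []          F x []      F≗a = eval-constP 1ℤ x
eval-prodSub (false ∷ S) F x (_ ∷ a) F≗a =
  trans (cong (λ p → eval p x) (prodSub-∷ false S F)) (eval-prodSub S (F ∘ suc) x a (F≗a ∘ suc))
eval-prodSub (true ∷ S)  F x (b ∷ a) F≗a =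
  trans (cong (λ p → eval p x) (prodSub-∷ true S F))
        (trans (eval-*P (F zero) (prodSub S (F ∘ suc)) x)
               (cong₂ _*ℤ_ (F≗a zero) (eval-prodSub S (F ∘ suc) x a (F≗a ∘ suc))))

eval-composeP : ∀ {m n} (p : Poly m) (F : Fin m → Poly n) x (a : Vec Bool m) →
                (∀ i → eval (F i) x ≡ 𝟙 (lookup a i)) → eval (composeP p F) x ≡ eval p a
eval-composeP {m} p F x a F≗a =
  trans (eval-sumP-map (λ S → scaleP (p S) (prodSub S F)) (allSubsets m) x)
        (∑-cong (λ S → trans (eval-scaleP (p S) (prodSub S F) x) (cong (p S *ℤ_) (eval-prodSub S F x a F≗a)))
                (allSubsets m))

deg≤-prodSub : ∀ {m n} (S : Subset m) (F : Fin m → Poly n) {d} →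
               (∀ i → Deg≤ (F i) d) → Deg≤ (prodSub S F) (∣ S ∣ * d)
deg≤-prodSub []          F F≤d = deg≤-constP 1ℤ
deg≤-prodSub (false ∷ S) F {d} F≤d =
  subst (λ p → Deg≤ p (∣ S ∣ * d)) (sym (prodSub-∷ false S F)) (deg≤-prodSub S (F ∘ suc) (F≤d ∘ suc))
deg≤-prodSub (true ∷ S)  F {d} F≤d =
  subst (λ p → Deg≤ p (d + ∣ S ∣ * d)) (sym (prodSub-∷ true S F))
        (deg≤-*P (F≤d zero) (deg≤-prodSub S (F ∘ suc) (F≤d ∘ suc)))

deg≤-composeP : ∀ {m n} {p : Poly m} {e} (F : Fin m → Poly n) {d} →
                Deg≤ p e → (∀ i → Deg≤ (F i) d) → Deg≤ (composeP p F) (e * d)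
deg≤-composeP {m} {p = p} {e} F {d} p≤e F≤d = deg≤-sumP (All.map⁺ (All.universal summand (allSubsets m)))
  where
  summand : ∀ S → Deg≤ (scaleP (p S) (prodSub S F)) (e * d)
  summand S with ∣ S ∣ ≤? e
  ... | yes ∣S∣≤e = deg≤-scaleP (p S) (deg≤-mono (ℕ.*-monoˡ-≤ d ∣S∣≤e) (deg≤-prodSub S F F≤d))
  ... | no  ∣S∣≰e = λ T _ → cong (_*ℤ prodSub S F T) (p≤e S (ℕ.≰⇒> ∣S∣≰e))

module _ {m n : ℕ} (f : Fin m → DT n Bool) where

  evalDTs : Vec Bool n → Vec Bool m
  evalDTs x = tabulate (λ i → evalDT (f i) x)

  eval-acceptP : ∀ x i → eval (acceptP (f i)) x ≡ 𝟙 (lookup (evalDTs x) i)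
  eval-acceptP x i = trans (eval-pathSumP (λ b → b) (f i) x) (cong 𝟙 (sym (Vec.lookup∘tabulate _ i)))

  litJ : Lit m → Junta n
  litJ (pos i) = pathJ (λ b → b) (f i)
  litJ (neg i) = pathJ not (f i)

  termJ : Term m → Junta n
  termJ []      = [] ∷ []
  termJ (l ∷ t) = litJ l ⊗ termJ t

  composeJ : Junta m → Junta n
  composeJ = concatMap termJ

  eval-litJ : ∀ l x → eval (juntaP (litJ l)) x ≡ 𝟙 (litHolds l (evalDTs x))
  eval-litJ (pos i) x = trans (eval-pathJ (λ b → b) (f i) x) (cong 𝟙 (sym (Vec.lookup∘tabulate _ i)))
  eval-litJ (neg i) x = trans (eval-pathJ not (f i) x) (cong (𝟙 ∘ not) (sym (Vec.lookup∘tabulate _ i)))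

  eval-termJ : ∀ t x → eval (juntaP (termJ t)) x ≡ eval (termP t) (evalDTs x)
  eval-termJ []      x = trans (eval-juntaP ([] ∷ []) x)
                               (trans (ℤ.+-identityʳ _) (trans (eval-constP 1ℤ x) (sym (eval-constP 1ℤ (evalDTs x)))))
  eval-termJ (l ∷ t) x =
    trans (eval-⊗ (litJ l) (termJ t) x)
          (trans (cong₂ _*ℤ_ (eval-litJ l x) (eval-termJ t x)) (sym (eval-termP-∷ l t (evalDTs x))))

  eval-composeJ : ∀ J x → eval (juntaP (composeJ J)) x ≡ eval (juntaP J) (evalDTs x)
  eval-composeJ J x = begin
    eval (juntaP (composeJ J)) x
      ≡⟨ eval-juntaP (composeJ J) x ⟩
    ∑ (composeJ J) (λ t → eval (termP t) x)
      ≡⟨ ∑-concatMap (λ t → eval (termP t) x) termJ J ⟩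
    ∑ J (λ t → ∑ (termJ t) (λ u → eval (termP u) x))
      ≡⟨ ∑-cong (λ t → trans (sym (eval-juntaP (termJ t) x)) (eval-termJ t x)) J ⟩
    ∑ J (λ t → eval (termP t) (evalDTs x))
      ≡⟨ eval-juntaP J (evalDTs x) ⟨
    eval (juntaP J) (evalDTs x)
      ∎
    where open ≡-Reasoning

  composeJ≈composeP : ∀ J → juntaP (composeJ J) ≈P composeP (juntaP J) (acceptP ∘ f)
  composeJ≈composeP J = eval-injective _ _ λ x →
    trans (eval-composeJ J x) (sym (eval-composeP (juntaP J) (acceptP ∘ f) x (evalDTs x) (eval-acceptP x)))

-- Sherali–Adams combinations

map-allFin-suc : ∀ {A : Set} {N} (h : Fin (suc N) → A) → map h (allFin (suc N)) ≡ h zero ∷ map (h ∘ suc) (allFin N)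
map-allFin-suc h = cong (h zero ∷_) (trans (List.map-tabulate suc h) (sym (List.map-tabulate (λ i → i) (h ∘ suc))))

∑-allFin-suc : ∀ {N} (h : Fin (suc N) → ℤ) → ∑ (allFin (suc N)) h ≡ h zero +ℤ ∑ (allFin N) (h ∘ suc)
∑-allFin-suc h = cong sumℤ (map-allFin-suc h)

∑-allFin-single : ∀ {N} (z : Fin N) (h : Fin N → ℤ) →
                  (∀ y → y ≢ z → h y ≡ 0ℤ) → ∑ (allFin N) h ≡ h z
∑-allFin-single {suc N} zero    h off =
  trans (∑-allFin-suc h) (trans (cong (h zero +ℤ_) (∑-zero (λ y → off (suc y) λ ()) (allFin N))) (ℤ.+-identityʳ _))
∑-allFin-single {suc N} (suc z) h off =
  trans (∑-allFin-suc h)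
        (trans (cong₂ _+ℤ_ (off zero λ ())
                           (∑-allFin-single z (h ∘ suc) (λ y y≢z → off (suc y) (y≢z ∘ Fin.suc-injective))))
               (ℤ.+-identityˡ _))

-- Positions in map φ xs, read as positions in xs.
at : ∀ {A B : Set} {φ : A → B} (xs : List A) → Fin (length (map φ xs)) → A
at (x ∷ xs) zero    = x
at (x ∷ xs) (suc k) = at xs k

module _ {A B : Set} {φ : A → B} where

  lookup-map-at : ∀ (xs : List A) k → List.lookup (map φ xs) k ≡ φ (at xs k)
  lookup-map-at (x ∷ xs) zero    = refl
  lookup-map-at (x ∷ xs) (suc k) = lookup-map-at xs k

  map-at-allFin : ∀ (xs : List A) → map (at xs) (allFin (length (map φ xs))) ≡ xs
  map-at-allFin []       = refl
  map-at-allFin (x ∷ xs) = trans (map-allFin-suc (at (x ∷ xs))) (cong (x ∷_) (map-at-allFin xs))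

  ∑-at : ∀ (xs : List A) (h : A → ℤ) → ∑ (allFin (length (map φ xs))) (h ∘ at xs) ≡ ∑ xs h
  ∑-at xs h = trans (sym (∑-map h (at xs) (allFin (length (map φ xs))))) (cong (λ ys → ∑ ys h) (map-at-allFin xs))

combination : ∀ {n} (Ps : List (Poly n)) → (Fin (length Ps) → Junta n) → Poly n
combination Ps Js = sumP (map (λ k → juntaP (Js k) *P List.lookup Ps k) (allFin (length Ps)))

eval-refutation : ∀ {n} {Ps : List (Poly n)} {D} (ref : SARefutation Ps D) → let open SARefutation ref in
  ∀ x → ∑ (allFin (length Ps)) (λ k → eval (juntaP (Js k) *P List.lookup Ps k) x) +ℤ eval (juntaP J) x ≡ -1ℤ
eval-refutation {Ps = Ps} ref x = begin
  ∑ (allFin (length Ps)) (λ k → eval (juntaP (Js k) *P List.lookup Ps k) x) +ℤ eval (juntaP J) x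
    ≡⟨ cong (_+ℤ eval (juntaP J) x)
            (eval-sumP-map (λ k → juntaP (Js k) *P List.lookup Ps k) (allFin (length Ps)) x) ⟨
  eval (combination Ps Js) x +ℤ eval (juntaP J) x
    ≡⟨ eval-+P (combination Ps Js) (juntaP J) x ⟨
  eval (combination Ps Js +P juntaP J) x
    ≡⟨ eval-≈P identity x ⟩
  eval (constP -1ℤ) x
    ≡⟨ eval-constP -1ℤ x ⟩
  -1ℤ
    ∎
  where
  open ≡-Reasoning
  open SARefutation ref

refutation-of-map : ∀ {n} {I : Set} (Ψ : I → Poly n) (items : List I) (M : I → Junta n) (J : Junta n) {D} →
  (∀ x → ∑ items (λ i → eval (juntaP (M i) *P Ψ i) x) +ℤ eval (juntaP J) x ≡ -1ℤ) →
  (∀ i → Deg≤ (juntaP (M i) *P Ψ i) D) → Deg≤ (juntaP J) D → SARefutation (map Ψ items) D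
refutation-of-map Ψ items M J {D} sum≡-1 deg-items deg-J = record
  { Js       = M ∘ at items
  ; J        = J
  ; identity = eval-injective _ _ identity
  ; degJsPs  = λ k → Deg≤⇒DegLE (subst (λ p → Deg≤ (juntaP (M (at items k)) *P p) D)
                                       (sym (lookup-map-at items k)) (deg-items (at items k)))
  ; degJ     = Deg≤⇒DegLE deg-J
  }
  where
  Ps = map Ψ items
  open ≡-Reasoning
  identity : ∀ x → eval (combination Ps (M ∘ at items) +P juntaP J) x ≡ eval (constP -1ℤ) x
  identity x = begin
    eval (combination Ps (M ∘ at items) +P juntaP J) x
      ≡⟨ eval-+P (combination Ps (M ∘ at items)) (juntaP J) x ⟩
    eval (combination Ps (M ∘ at items)) x +ℤ eval (juntaP J) x
      ≡⟨ cong (_+ℤ eval (juntaP J) x) (eval-sumP-map _ (allFin (length Ps)) x) ⟩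
    ∑ (allFin (length Ps)) (λ k → eval (juntaP (M (at items k)) *P List.lookup Ps k) x) +ℤ eval (juntaP J) x
      ≡⟨ cong (_+ℤ eval (juntaP J) x)
              (∑-cong (λ k → cong (λ p → eval (juntaP (M (at items k)) *P p) x) (lookup-map-at items k))
                      (allFin (length Ps))) ⟩
    ∑ (allFin (length Ps)) (λ k → eval (juntaP (M (at items k)) *P Ψ (at items k)) x) +ℤ eval (juntaP J) x
      ≡⟨ cong (_+ℤ eval (juntaP J) x) (∑-at items (λ i → eval (juntaP (M i) *P Ψ i) x)) ⟩
    ∑ items (λ i → eval (juntaP (M i) *P Ψ i) x) +ℤ eval (juntaP J) x
      ≡⟨ sum≡-1 x ⟩
    -1ℤ
      ≡⟨ eval-constP -1ℤ x ⟨
    eval (constP -1ℤ) x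
      ∎

map-cartesianProduct : ∀ {A B C : Set} (h : A → B → C) xs ys →
  map (λ ab → h (proj₁ ab) (proj₂ ab)) (List.cartesianProduct xs ys) ≡ concatMap (λ a → map (h a) ys) xs
map-cartesianProduct h []       ys = refl
map-cartesianProduct h (x ∷ xs) ys =
  trans (List.map-++ _ (map (x ,_) ys) _) (cong₂ _++_ (sym (List.map-∘ ys)) (map-cartesianProduct h xs ys))

m+n*m≤m*[n+2] : ∀ m n → m + n * m ≤ m * (n + 2)
m+n*m≤m*[n+2] m n = ℕ.≤-trans (ℕ.m≤m+n (m + n * m) m) (ℕ.≤-reflexive (expand m n))
  where
  expand : ∀ m n → m + n * m + m ≡ m * (n + 2)
  expand = ℕ-solve-∀

-- The reduction

module Reduction {Q R : TFΣ2dt} {s d : ℕ → ℕ} (F : Formulation Q R s d) (n : ℕ)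
                 {e : ℕ} (ref : SARefutation (TFΣ2dt.formula R (s n)) e) where

  open Formulation F
  open SARefutation ref

  m : ℕ
  m = s n

  rejections : Fin (R.O m) → Poly m
  rejections b = sumP (map (λ c → rejectP (R.tree m b c)) (allFin (R.W m)))

  -- R.formula m and reducedFormula n are, definitionally, map φ and concatMap of map ψ over Fin (R.O m).
  φ : Fin (R.O m) → Poly m
  φ b = rejections b -P 1P

  ψ : Fin (R.O m) → Fin (Q.O n) → Poly n
  ψ b y = (Gbar n b y +P sumP (map (λ c → composeP (rejectP (R.tree m b c)) (acceptP ∘ f n)) (allFin (R.W m)))) -P 1P

  formulaAt : Fin (length (R.formula m)) → Poly m
  formulaAt = List.lookup (R.formula m)

  origin : Fin (length (R.formula m)) → Fin (R.O m)
  origin = at {φ = φ} (allFin (R.O m))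

  Item : Set
  Item = Fin (length (R.formula m)) × Fin (Q.O n)

  items : List Item
  items = List.cartesianProduct (allFin (length (R.formula m))) (allFin (Q.O n))

  Ψ : Item → Poly n
  Ψ (k , y) = ψ (origin k) y

  reducedFormula≡map-Ψ : map Ψ items ≡ reducedFormula n
  reducedFormula≡map-Ψ = begin
    map Ψ items
      ≡⟨ map-cartesianProduct (ψ ∘ origin) positions Ys ⟩
    concatMap (λ k → map (ψ (origin k)) Ys) positions
      ≡⟨ List.concatMap-map (λ b → map (ψ b) Ys) origin positions ⟨
    concatMap (λ b → map (ψ b) Ys) (map origin positions)
      ≡⟨ cong (concatMap (λ b → map (ψ b) Ys)) (map-at-allFin (allFin (R.O m))) ⟩
    reducedFormula n
      ∎
    where
    open ≡-Reasoning
    positions = allFin (length (R.formula m))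
    Ys = allFin (Q.O n)

  answers : Fin (R.O m) → Fin (Q.O n) → Vec Bool n → Bool
  answers b y x = does (evalDT (g n b) x ≟ y)

  eval-ψ : ∀ b y x → eval (ψ b y) x ≡ 𝟙 (not (answers b y x)) +ℤ eval (φ b) (fx n x)
  eval-ψ b y x = begin
    eval (ψ b y) x
      ≡⟨ eval--P (Gbar n b y +P composed) 1P x ⟩
    eval (Gbar n b y +P composed) x -ℤ eval 1P x
      ≡⟨ cong₂ _-ℤ_ (eval-+P (Gbar n b y) composed x) (eval-constP 1ℤ x) ⟩
    eval (Gbar n b y) x +ℤ eval composed x -ℤ 1ℤ
      ≡⟨ cong (λ u → u +ℤ eval composed x -ℤ 1ℤ) (eval-pathSumP (λ z → not (does (z ≟ y))) (g n b) x) ⟩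
    𝟙 (not (answers b y x)) +ℤ eval composed x -ℤ 1ℤ
      ≡⟨ ℤ.+-assoc (𝟙 (not (answers b y x))) (eval composed x) -1ℤ ⟩
    𝟙 (not (answers b y x)) +ℤ (eval composed x -ℤ 1ℤ)
      ≡⟨ cong (λ u → 𝟙 (not (answers b y x)) +ℤ (u -ℤ 1ℤ)) eval-composed ⟩
    𝟙 (not (answers b y x)) +ℤ (eval (rejections b) (fx n x) -ℤ 1ℤ)
      ≡⟨ cong (λ u → 𝟙 (not (answers b y x)) +ℤ (eval (rejections b) (fx n x) -ℤ u))
              (eval-constP 1ℤ (fx n x)) ⟨
    𝟙 (not (answers b y x)) +ℤ (eval (rejections b) (fx n x) -ℤ eval 1P (fx n x))
      ≡⟨ cong (𝟙 (not (answers b y x)) +ℤ_) (eval--P (rejections b) 1P (fx n x)) ⟨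
    𝟙 (not (answers b y x)) +ℤ eval (φ b) (fx n x)
      ∎
    where
    open ≡-Reasoning
    composed : Poly n
    composed = sumP (map (λ c → composeP (rejectP (R.tree m b c)) (acceptP ∘ f n)) (allFin (R.W m)))
    eval-composed : eval composed x ≡ eval (rejections b) (fx n x)
    eval-composed =
      trans (eval-sumP-map (λ c → composeP (rejectP (R.tree m b c)) (acceptP ∘ f n)) (allFin (R.W m)) x)
            (trans (∑-cong (λ c → eval-composeP (rejectP (R.tree m b c)) (acceptP ∘ f n) x (fx n x)
                                                (eval-acceptP (f n) x))
                           (allFin (R.W m)))
                   (sym (eval-sumP-map (λ c → rejectP (R.tree m b c)) (allFin (R.W m)) (fx n x))))

  multiplier : Item → Junta n
  multiplier (k , y) = composeJ (f n) (Js k) ⊗ pathJ (λ z → does (z ≟ y)) (g n (origin k))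

  -- Where g_b answers y the term Gbar_{b,y} of ψ_{b,y} vanishes, and elsewhere the multiplier does.
  eval-multiplier-Ψ : ∀ k y x → eval (juntaP (multiplier (k , y)) *P Ψ (k , y)) x
                      ≡ 𝟙 (answers (origin k) y x) *ℤ eval (juntaP (Js k) *P formulaAt k) (fx n x)
  eval-multiplier-Ψ k y x = begin
    eval (juntaP (multiplier (k , y)) *P Ψ (k , y)) x
      ≡⟨ eval-*P (juntaP (multiplier (k , y))) (Ψ (k , y)) x ⟩
    eval (juntaP (multiplier (k , y))) x *ℤ eval (Ψ (k , y)) x
      ≡⟨ cong₂ _*ℤ_ (eval-⊗ (composeJ (f n) (Js k)) (pathJ (λ z → does (z ≟ y)) (g n b)) x) (eval-ψ b y x) ⟩
    eval (juntaP (composeJ (f n) (Js k))) x *ℤ eval (juntaP (pathJ (λ z → does (z ≟ y)) (g n b))) x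
      *ℤ (𝟙 (not (answers b y x)) +ℤ eval (φ b) (fx n x))
      ≡⟨ cong₂ (λ u v → u *ℤ v *ℤ (𝟙 (not (answers b y x)) +ℤ eval (φ b) (fx n x)))
               (eval-composeJ (f n) (Js k) x) (eval-pathJ (λ z → does (z ≟ y)) (g n b) x) ⟩
    eval (juntaP (Js k)) (fx n x) *ℤ 𝟙 (answers b y x) *ℤ (𝟙 (not (answers b y x)) +ℤ eval (φ b) (fx n x))
      ≡⟨ gate (answers b y x) (eval (juntaP (Js k)) (fx n x)) (eval (φ b) (fx n x)) ⟩
    𝟙 (answers b y x) *ℤ (eval (juntaP (Js k)) (fx n x) *ℤ eval (φ b) (fx n x))
      ≡⟨ cong (𝟙 (answers b y x) *ℤ_) (eval-*P (juntaP (Js k)) (φ b) (fx n x)) ⟨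
    𝟙 (answers b y x) *ℤ eval (juntaP (Js k) *P φ b) (fx n x)
      ≡⟨ cong (λ p → 𝟙 (answers b y x) *ℤ eval (juntaP (Js k) *P p) (fx n x)) (lookup-map-at (allFin (R.O m)) k) ⟨
    𝟙 (answers b y x) *ℤ eval (juntaP (Js k) *P formulaAt k) (fx n x)
      ∎
    where
    open ≡-Reasoning
    b = origin k
    gate : ∀ L j u → j *ℤ 𝟙 L *ℤ (𝟙 (not L) +ℤ u) ≡ 𝟙 L *ℤ (j *ℤ u)
    gate true  j u = trans (cong₂ _*ℤ_ (ℤ.*-identityʳ j) (ℤ.+-identityˡ u)) (sym (ℤ.*-identityˡ _))
    gate false j u = cong (_*ℤ (1ℤ +ℤ u)) (ℤ.*-zeroʳ j)

  multiplier-Ψ≈ : ∀ k y → (juntaP (multiplier (k , y)) *P Ψ (k , y))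
                  ≈P (G n (origin k) y *P composeP (juntaP (Js k) *P formulaAt k) (acceptP ∘ f n))
  multiplier-Ψ≈ k y = eval-injective _ _ λ x → begin
    eval (juntaP (multiplier (k , y)) *P Ψ (k , y)) x
      ≡⟨ eval-multiplier-Ψ k y x ⟩
    𝟙 (answers (origin k) y x) *ℤ eval (juntaP (Js k) *P formulaAt k) (fx n x)
      ≡⟨ cong₂ _*ℤ_ (eval-pathSumP (λ z → does (z ≟ y)) (g n (origin k)) x)
                    (eval-composeP (juntaP (Js k) *P formulaAt k) (acceptP ∘ f n) x (fx n x) (eval-acceptP (f n) x)) ⟨
    eval (G n (origin k) y) x *ℤ eval (composeP (juntaP (Js k) *P formulaAt k) (acceptP ∘ f n)) x
      ≡⟨ eval-*P (G n (origin k) y) _ x ⟨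
    eval (G n (origin k) y *P composeP (juntaP (Js k) *P formulaAt k) (acceptP ∘ f n)) x
      ∎
    where open ≡-Reasoning

  deg≤-acceptP : ∀ i → Deg≤ (acceptP (f n i)) (d n)
  deg≤-acceptP i = deg≤-pathSumP (λ b → b) (f n i) (f-depth n i)

  deg≤-multiplier-Ψ : ∀ i → Deg≤ (juntaP (multiplier i) *P Ψ i) (d n * (e + 2))
  deg≤-multiplier-Ψ (k , y) = deg≤-≈P (λ S → sym (multiplier-Ψ≈ k y S))
    (deg≤-mono (m+n*m≤m*[n+2] (d n) e)
      (deg≤-*P (deg≤-pathSumP (λ z → does (z ≟ y)) (g n (origin k)) (g-depth n (origin k)))
               (deg≤-composeP (acceptP ∘ f n) (DegLE⇒Deg≤ (degJsPs k)) deg≤-acceptP)))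

  junta : Junta n
  junta = composeJ (f n) J

  deg≤-junta : Deg≤ (juntaP junta) (d n * (e + 2))
  deg≤-junta = deg≤-≈P (λ S → sym (composeJ≈composeP (f n) J S))
    (deg≤-mono (ℕ.≤-trans (ℕ.m≤n+m (e * d n) (d n)) (m+n*m≤m*[n+2] (d n) e))
      (deg≤-composeP (acceptP ∘ f n) (DegLE⇒Deg≤ degJ) deg≤-acceptP))

  lifted-identity : ∀ x → ∑ items (λ i → eval (juntaP (multiplier i) *P Ψ i) x) +ℤ eval (juntaP junta) x ≡ -1ℤ
  lifted-identity x = begin
    ∑ items (λ i → eval (juntaP (multiplier i) *P Ψ i) x) +ℤ eval (juntaP junta) x
      ≡⟨ cong₂ _+ℤ_ (∑-cartesianProductWith (λ i → eval (juntaP (multiplier i) *P Ψ i) x) _,_ positions Ys)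
                    (eval-composeJ (f n) J x) ⟩
    ∑ positions (λ k → ∑ Ys (λ y → eval (juntaP (multiplier (k , y)) *P Ψ (k , y)) x)) +ℤ eval (juntaP J) (fx n x)
      ≡⟨ cong (_+ℤ eval (juntaP J) (fx n x))
              (∑-cong (λ k → ∑-cong (λ y → eval-multiplier-Ψ k y x) Ys) positions) ⟩
    ∑ positions (λ k → ∑ Ys (λ y → 𝟙 (answers (origin k) y x) *ℤ E k)) +ℤ eval (juntaP J) (fx n x)
      ≡⟨ cong (_+ℤ eval (juntaP J) (fx n x)) (∑-cong exactly-one-answer positions) ⟩
    ∑ positions E +ℤ eval (juntaP J) (fx n x)
      ≡⟨ eval-refutation ref (fx n x) ⟩
    -1ℤ
      ∎
    where
    open ≡-Reasoning
    positions = allFin (length (R.formula m))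
    Ys = allFin (Q.O n)
    E : Fin (length (R.formula m)) → ℤ
    E k = eval (juntaP (Js k) *P formulaAt k) (fx n x)
    exactly-one-answer : ∀ k → ∑ Ys (λ y → 𝟙 (answers (origin k) y x) *ℤ E k) ≡ E k
    exactly-one-answer k =
      trans (∑-allFin-single answer _
                (λ y y≢answer → cong (λ L → 𝟙 L *ℤ E k) (dec-false (answer ≟ y) (y≢answer ∘ sym))))
            (trans (cong (λ L → 𝟙 L *ℤ E k) (dec-true (answer ≟ answer) refl)) (ℤ.*-identityˡ (E k)))
      where
      answer = evalDT (g n (origin k)) x

proposition5p8 : (Q R : TFΣ2dt) (s d d′ : ℕ → ℕ) (F : Formulation Q R s d) →
    (∀ m → SARefutation (TFΣ2dt.formula R m) (d′ m)) →
    ∀ n → SARefutation (Formulation.reducedFormula F n) (d n * (d′ (s n) + 2))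
proposition5p8 Q R s d d′ F refute n =
  subst (λ Ps → SARefutation Ps (d n * (d′ (s n) + 2))) reducedFormula≡map-Ψ
        (refutation-of-map Ψ items multiplier junta lifted-identity deg≤-multiplier-Ψ deg≤-junta)
  where open Reduction F n (refute (s n))
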